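{- Let $\mathcal{P}$ be an $\mathrm{ASP^{fs}}$ program and $\mathcal{Q}$ a query finitely recursive on $\mathcal{P}$. Then $\mathrm{DMS}(\mathcal{Q},\mathcal{P})$ is stratified.
   Context: Terms are variables or functional terms $f(t_1,\dots,t_k)$. A rule $r$: $a_1 \vee \dots \vee a_n \leftarrow b_1,\dots,b_j,\mathrm{not}\,b_{j+1},\dots,\mathrm{not}\,b_m$ ($n\ge1$); $H(r)$, $B^+(r)$, $B^-(r)$ are head, positive body, negative body atoms, $\mathrm{atoms}(r)$ their union. A program is a finite set of rules. A predicate $p$ depends on $q$ if some rule has a $p$-atom in its head and a $q$-atom in its body, negatively if the $q$-atom is in $B^-$; a program is stratified if no cycle of dependencies contains a negative dependency. An $\mathrm{ASP^{fs}}$ program is a stratified program, disjunction and function symbols allowed. A fact is a variable-free rule with empty body and one head atom; a predicate is EDB if all its defining rules are facts, IDB otherwise; $\mathrm{EDB}(\mathcal{P})$ is the set of rules with no IDB head predicate. $\mathrm{Ground}(\mathcal{P})$ is the set of ground instances over ground terms built from $\mathcal{P}$'s function symbols. A query is a ground atom $\mathcal{Q}=g(\bar t)$ with function symbols in $\mathcal{P}$; it is finitely recursive on $\mathcal{P}$ if finitely many ground atoms are relevant, the relevant atoms being $\mathcal{Q}$ and all atoms of $\mathrm{atoms}(r_g)$ for $r_g\in\mathrm{Ground}(\mathcal{P})$ with a relevant head atom. $\mathrm{DMS}(\mathcal{Q},\mathcal{P})$: with fresh predicates $\mathrm{magic\_}p$ (same arity as $p$), initialize $D=\emptyset$, $\mathit{modifiedRules}=\emptyset$,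 $\mathit{magicRules}=\{\mathrm{magic\_}g(\bar t).\}$, $S=\{g\}$; while $S\neq\emptyset$, move a predicate $p$ from $S$ to $D$ and, for each $r\in\mathcal{P}$ and each $p(\bar t)\in H(r)$: add to $\mathit{modifiedRules}$ the rule $r$ with $\mathrm{magic\_}q(\bar s)$ added to its body for every $q(\bar s)\in H(r)$; for each $q(\bar s)\in\mathrm{atoms}(r)\setminus\{p(\bar t)\}$ with $q$ IDB, add $\mathrm{magic\_}q(\bar s)\leftarrow\mathrm{magic\_}p(\bar t)$ to $\mathit{magicRules}$ and add $q$ to $S$ if $q\notin D$. Output $\mathit{magicRules}\cup\mathit{modifiedRules}\cup\mathrm{EDB}(\mathcal{P})$. -}

module Defs where

open import Data.Nat using (ℕ; _≡ᵇ_)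
open import Data.Bool using (Bool; true; false; _∧_; _∨_; not; if_then_else_)
open import Data.List using (List; []; _∷_; _++_; map; length; concatMap; foldl; filterᵇ; null)
open import Data.List.Membership.Propositional using (_∈_)
open import Data.List.Relation.Unary.All using (All)
open import Data.Product using (_×_; _,_; ∃; ∃-syntax)
open import Relation.Binary.PropositionalEquality using (_≡_; _≢_)
open import Relation.Binary.Construct.Closure.ReflexiveTransitive using (Star)
open import Relation.Nullary using (¬_)

-- Syntax.  Predicate symbols and function symbols are named by ℕ.
-- Constants are 0-ary function symbols.  A function symbol is identified
-- by (name , arity).

data Term : Set where
  var : ℕ → Term
  fn  : ℕ → List Term → Term

record Atom (Pr : Set) : Set where
  constructor atom
  field
    pred : Pr
    args : List Term
open Atom public

-- a₁ ∨ … ∨ aₙ ← b₁,…,bⱼ, not bⱼ₊₁, …, not bₘ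
record Rule (Pr : Set) : Set where
  constructor rule
  field
    head : List (Atom Pr)
    pos  : List (Atom Pr)
    neg  : List (Atom Pr)
open Rule public

Program : Set → Set
Program Pr = List (Rule Pr)

body : ∀ {Pr} → Rule Pr → List (Atom Pr)
body r = pos r ++ neg r

atoms : ∀ {Pr} → Rule Pr → List (Atom Pr)
atoms r = head r ++ pos r ++ neg r

Depends : ∀ {Pr} → Program Pr → Pr → Pr → Set
Depends P p q = ∃[ r ] (r ∈ P × (∃[ a ] (a ∈ head r × pred a ≡ p))
                              × (∃[ b ] (b ∈ body r × pred b ≡ q)))

NegDepends : ∀ {Pr} → Program Pr → Pr → Pr → Set
NegDepends P p q = ∃[ r ] (r ∈ P × (∃[ a ] (a ∈ head r × pred a ≡ p))
                                 × (∃[ b ] (b ∈ neg r × pred b ≡ q)))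

Stratified : ∀ {Pr} → Program Pr → Set
Stratified P = ∀ p q → NegDepends P p q → ¬ Star (Depends P) q p

HeadNonEmpty : ∀ {Pr} → Rule Pr → Set
HeadNonEmpty r = head r ≢ []

ASPfs : Program ℕ → Set
ASPfs P = All HeadNonEmpty P × Stratified P

FunSym : Set
FunSym = ℕ × ℕ

mutual
  symsT : Term → List FunSym
  symsT (var _)   = []
  symsT (fn f ts) = (f , length ts) ∷ symsTs ts

  symsTs : List Term → List FunSym
  symsTs []       = []
  symsTs (t ∷ ts) = symsT t ++ symsTs ts

mutual
  varsT : Term → List ℕ
  varsT (var x)   = x ∷ []
  varsT (fn f ts) = varsTs ts

  varsTs : List Term → List ℕ
  varsTs []       = []
  varsTs (t ∷ ts) = varsT t ++ varsTs ts

symsRule : ∀ {Pr} → Rule Pr → List FunSym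
symsRule r = concatMap (λ a → symsTs (args a)) (atoms r)

symsProg : ∀ {Pr} → Program Pr → List FunSym
symsProg P = concatMap symsRule P

varsRule : ∀ {Pr} → Rule Pr → List ℕ
varsRule r = concatMap (λ a → varsTs (args a)) (atoms r)

data GroundOver (Σ : List FunSym) : Term → Set where
  fn : ∀ f ts → (f , length ts) ∈ Σ → All (GroundOver Σ) ts → GroundOver Σ (fn f ts)

mutual
  substT : (ℕ → Term) → Term → Term
  substT σ (var x)   = σ x
  substT σ (fn f ts) = fn f (substTs σ ts)

  substTs : (ℕ → Term) → List Term → List Term
  substTs σ []       = []
  substTs σ (t ∷ ts) = substT σ t ∷ substTs σ ts

substA : ∀ {Pr} → (ℕ → Term) → Atom Pr → Atom Pr
substA σ a = atom (pred a) (substTs σ (args a))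

substR : ∀ {Pr} → (ℕ → Term) → Rule Pr → Rule Pr
substR σ r = rule (map (substA σ) (head r)) (map (substA σ) (pos r)) (map (substA σ) (neg r))

InGround : Program ℕ → Rule ℕ → Set
InGround P rg = ∃[ r ] (r ∈ P × ∃[ σ ] ((∀ x → x ∈ varsRule r → GroundOver (symsProg P) (σ x))
                                        × rg ≡ substR σ r))

IsQuery : Program ℕ → Atom ℕ → Set
IsQuery P Q = All (GroundOver (symsProg P)) (args Q)

data Relevant (P : Program ℕ) (Q : Atom ℕ) : Atom ℕ → Set where
  query : Relevant P Q Q
  step  : ∀ {rg a b} → InGround P rg → a ∈ head rg → Relevant P Q a →
          b ∈ atoms rg → Relevant P Q b

FinitelyRecursive : Program ℕ → Atom ℕ → Set
FinitelyRecursive P Q = ∃[ L ] (∀ a → Relevant P Q a → a ∈ L)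

anyᵇ : ∀ {A : Set} → (A → Bool) → List A → Bool
anyᵇ f []       = false
anyᵇ f (x ∷ xs) = f x ∨ anyᵇ f xs

elemℕ : ℕ → List ℕ → Bool
elemℕ n = anyᵇ (n ≡ᵇ_)

isFact : ∀ {Pr} → Rule Pr → Bool
isFact r = null (body r) ∧ (length (head r) ≡ᵇ 1) ∧ null (varsRule r)

isIDB : Program ℕ → ℕ → Bool
isIDB P p = anyᵇ (λ r → anyᵇ (λ a → pred a ≡ᵇ p) (head r) ∧ not (isFact r)) P

EDB : Program ℕ → Program ℕ
EDB P = filterᵇ (λ r → not (anyᵇ (λ a → isIDB P (pred a)) (head r))) P

mutual
  termEq : Term → Term → Bool
  termEq (var x)   (var y)   = x ≡ᵇ y
  termEq (fn f ts) (fn g us) = (f ≡ᵇ g) ∧ termsEq ts us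
  termEq _         _         = false

  termsEq : List Term → List Term → Bool
  termsEq []       []       = true
  termsEq (t ∷ ts) (u ∷ us) = termEq t u ∧ termsEq ts us
  termsEq _        _        = false

atomEq : Atom ℕ → Atom ℕ → Bool
atomEq a b = (pred a ≡ᵇ pred b) ∧ termsEq (args a) (args b)

data MPred : Set where
  orig  : ℕ → MPred
  magic : ℕ → MPred

liftA : Atom ℕ → Atom MPred
liftA a = atom (orig (pred a)) (args a)

magicA : Atom ℕ → Atom MPred
magicA a = atom (magic (pred a)) (args a)

liftR : Rule ℕ → Rule MPred
liftR r = rule (map liftA (head r)) (map liftA (pos r)) (map liftA (neg r))

record State : Set where
  constructor state
  field
    D S           : List ℕ
    magicRules    : List (Rule MPred)
    modifiedRules : List (Rule MPred)
open State public

-- for r and a head atom a = p(t̄) of r: add the modified rule, and for each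
-- q(s̄) ∈ atoms(r) ∖ {p(t̄)} with q IDB add magic_q(s̄) ← magic_p(t̄),
-- and add q to S if q ∉ D
handleOther : Program ℕ → Atom ℕ → State → Atom ℕ → State
handleOther P a st b =
  if not (atomEq b a) ∧ isIDB P (pred b)
  then state (D st)
             (if elemℕ (pred b) (D st) then S st else pred b ∷ S st)
             (rule (magicA b ∷ []) (magicA a ∷ []) [] ∷ magicRules st)
             (modifiedRules st)
  else st

handleHeadAtom : Program ℕ → Rule ℕ → State → Atom ℕ → State
handleHeadAtom P r st a =
  foldl (handleOther P a)
        (state (D st) (S st) (magicRules st)
               (rule (map liftA (head r)) (map liftA (pos r) ++ map magicA (head r))
                     (map liftA (neg r)) ∷ modifiedRules st))
        (atoms r)

processPred : Program ℕ → ℕ → State → State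
processPred P p st =
  foldl (λ st₁ r → foldl (λ st₂ a → if pred a ≡ᵇ p then handleHeadAtom P r st₂ a else st₂)
                         st₁ (head r))
        st P

-- one iteration of the while loop: move some p from S to D, then process it
data Step (P : Program ℕ) : State → State → Set where
  pick : ∀ {st} p → p ∈ S st →
         Step P st (processPred P p
                      (state (p ∷ D st) (filterᵇ (λ q → not (q ≡ᵇ p)) (S st))
                             (magicRules st) (modifiedRules st)))

initState : Atom ℕ → State
initState Q = state [] (pred Q ∷ []) (rule (magicA Q ∷ []) [] [] ∷ []) []

dmsOutput : Program ℕ → State → Program MPred
dmsOutput P st = magicRules st ++ modifiedRules st ++ map liftR (EDB P)

-- DMS(Q,P) = O: the output of some terminated run of the algorithm
-- (every choice order of the while loop is allowed)
IsDMS : Atom ℕ → Program ℕ → Program MPred → Set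
IsDMS Q P O = ∃[ st ] (Star (Step P) (initState Q) st × S st ≡ [] × O ≡ dmsOutput P st)

module Submission where

-- DMS adds only rules of two shapes: magic rules, whose bodies are positive and
-- consist of magic atoms, and the rules of P lifted to the original predicates
-- with extra magic atoms added to their positive bodies. Hence every
-- dependency of the output either leads into a magic predicate, from which no
-- path ever leaves the magic predicates, or is the lift of a dependency of P;
-- negative dependencies are always lifts. A dependency cycle through a
-- negative edge of the output therefore lies among original predicates and
-- projects to such a cycle of P.

open import Defs
open import Data.Nat using (ℕ; _≡ᵇ_)
open import Data.Bool using (true; false; not; _∧_; if_then_else_)
open import Data.List using (List; []; _∷_; _++_; map; foldl)
open import Data.List.Properties using (++-identityʳ)
open import Data.List.Membership.Propositional using (_∈_)
open import Data.List.Membership.Propositional.Properties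
  using (∈-map⁻; ∈-++⁻; ∈-++⁺ˡ; ∈-++⁺ʳ; ∈-filter⁻)
open import Data.List.Relation.Unary.All as All using (All; []; _∷_)
open import Data.List.Relation.Unary.All.Properties using (++⁺; map⁺)
open import Data.Product using (_×_; _,_; ∃-syntax; proj₁)
open import Data.Sum using (_⊎_; inj₁; inj₂)
open import Data.Unit using (⊤; tt)
open import Data.Empty using (⊥; ⊥-elim)
open import Function using (_∘_; id)
open import Relation.Binary.PropositionalEquality using (_≡_; refl; sym; cong; subst)
open import Relation.Binary.Construct.Closure.ReflexiveTransitive using (Star; ε; _◅_)

private
  variable
    A B : Set
    P : Program ℕ
    O : Program MPred

foldl-preservesᵃ : {Q : A → Set} (I : B → Set) {f : B → A → B} →
                   (∀ {b x} → Q x → I b → I (f b x)) →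
                   ∀ {xs} → All Q xs → ∀ {b} → I b → I (foldl f b xs)
foldl-preservesᵃ I pres []         Ib = Ib
foldl-preservesᵃ I pres (qx ∷ qxs) Ib = foldl-preservesᵃ I pres qxs (pres qx Ib)

foldl-preservesʳ : (I : B → Set) {f : B → A → B} → (∀ {b} x → I b → I (f b x)) →
                   ∀ xs {b} → I b → I (foldl f b xs)
foldl-preservesʳ I pres xs =
  foldl-preservesᵃ I (λ {_} {x} _ → pres x) (All.universal (λ _ → tt) xs)

PredIn : {Pr : Set} → Pr → List (Atom Pr) → Set
PredIn p as = ∃[ a ] (a ∈ as × pred a ≡ p)

module _ {Pr : Set} {p : Pr} where

  PredIn-++⁻ : ∀ as {bs} → PredIn p (as ++ bs) → PredIn p as ⊎ PredIn p bs
  PredIn-++⁻ as (a , a∈ , eq) with ∈-++⁻ as a∈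
  ... | inj₁ a∈as = inj₁ (a , a∈as , eq)
  ... | inj₂ a∈bs = inj₂ (a , a∈bs , eq)

  PredIn-++⁺ˡ : ∀ {as bs} → PredIn p as → PredIn p (as ++ bs)
  PredIn-++⁺ˡ (a , a∈ , eq) = a , ∈-++⁺ˡ a∈ , eq

  PredIn-++⁺ʳ : ∀ as {bs} → PredIn p bs → PredIn p (as ++ bs)
  PredIn-++⁺ʳ as (a , a∈ , eq) = a , ∈-++⁺ʳ as a∈ , eq

PredIn-map-liftA⁻ : ∀ {x as} → PredIn x (map liftA as) → ∃[ p ] (x ≡ orig p × PredIn p as)
PredIn-map-liftA⁻ (_ , a∈ , refl) with ∈-map⁻ liftA a∈
... | a , a∈as , refl = pred a , refl , a , a∈as , refl

IsMagic : MPred → Set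
IsMagic (orig _)  = ⊥
IsMagic (magic _) = ⊤

MagicAtoms : List (Atom MPred) → Set
MagicAtoms = All (IsMagic ∘ pred)

PredIn-magic : ∀ {x as} → MagicAtoms as → PredIn x as → IsMagic x
PredIn-magic magics (a , a∈ , refl) = All.lookup magics a∈

MagicRule : Rule MPred → Set
MagicRule R = MagicAtoms (pos R) × neg R ≡ []

guardR : Rule ℕ → List (Atom MPred) → Rule MPred
guardR r guards = rule (map liftA (head r)) (map liftA (pos r) ++ guards) (map liftA (neg r))

ModifiedRule : Program ℕ → Rule MPred → Set
ModifiedRule P R = ∃[ r ] (r ∈ P × ∃[ guards ] (MagicAtoms guards × R ≡ guardR r guards))

DMSRule : Program ℕ → Rule MPred → Set
DMSRule P R = MagicRule R ⊎ ModifiedRule P R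

liftR-modified : ∀ {r} → r ∈ P → ModifiedRule P (liftR r)
liftR-modified {r = r} r∈P =
  r , r∈P , [] , [] , cong (λ ps → rule (map liftA (head r)) ps (map liftA (neg r)))
                           (sym (++-identityʳ (map liftA (pos r))))

data OrigEdge (S : ℕ → ℕ → Set) : MPred → MPred → Set where
  lift : ∀ {p q} → S p q → OrigEdge S (orig p) (orig q)

OrigOrMagic : (MPred → MPred → Set) → (ℕ → ℕ → Set) → Set
OrigOrMagic R S = ∀ {x y} → R x y → OrigEdge S x y ⊎ IsMagic y

module _ {R : MPred → MPred → Set} {S : ℕ → ℕ → Set} (classify : OrigOrMagic R S) where

  magic-closed : ∀ {x y} → IsMagic x → Star R x y → IsMagic y
  magic-closed mx ε = mx
  magic-closed mx (e ◅ es) with classify e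
  ... | inj₂ my       = magic-closed my es
  ... | inj₁ (lift _) = ⊥-elim mx

  orig-path : ∀ {q p} → Star R (orig q) (orig p) → Star S q p
  orig-path ε = ε
  orig-path (e ◅ es) with classify e
  ... | inj₂ my       = ⊥-elim (magic-closed my es)
  ... | inj₁ (lift s) = s ◅ orig-path es

stratified-reflect : OrigOrMagic (Depends O) (Depends P) →
                     (∀ {x y} → NegDepends O x y → OrigEdge (NegDepends P) x y) →
                     Stratified P → Stratified O
stratified-reflect depends negDepends strat x y neg cycle with negDepends neg
... | lift nd = strat _ _ nd (orig-path depends cycle)

guardR-body⁻ : ∀ r guards {y} → PredIn y (body (guardR r guards)) →
               PredIn y guards ⊎ ∃[ q ] (y ≡ orig q × PredIn q (body r))
guardR-body⁻ r guards y∈ with PredIn-++⁻ (map liftA (pos r) ++ guards) y∈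
... | inj₂ y∈neg with PredIn-map-liftA⁻ y∈neg
...   | q , refl , q∈ = inj₂ (q , refl , PredIn-++⁺ʳ (pos r) q∈)
guardR-body⁻ r guards y∈ | inj₁ y∈pg with PredIn-++⁻ (map liftA (pos r)) y∈pg
... | inj₂ y∈guards = inj₁ y∈guards
... | inj₁ y∈pos with PredIn-map-liftA⁻ y∈pos
...   | q , refl , q∈ = inj₂ (q , refl , PredIn-++⁺ˡ q∈)

DMSRule-depends : ∀ {R x y} → DMSRule P R → PredIn x (head R) → PredIn y (body R) →
                  OrigEdge (Depends P) x y ⊎ IsMagic y
DMSRule-depends {R = rule _ ps .[]} (inj₁ (magics , refl)) _ (b , b∈ , eq) =
  inj₂ (PredIn-magic magics (b , subst (b ∈_) (++-identityʳ ps) b∈ , eq))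
DMSRule-depends (inj₂ (r , r∈P , guards , magics , refl)) x∈ y∈
  with PredIn-map-liftA⁻ x∈ | guardR-body⁻ r guards y∈
... | _ , refl , p∈ | inj₁ y∈guards       = inj₂ (PredIn-magic magics y∈guards)
... | _ , refl , p∈ | inj₂ (_ , refl , q∈) = inj₁ (lift (r , r∈P , p∈ , q∈))

DMSRule-negDepends : ∀ {R x y} → DMSRule P R → PredIn x (head R) → PredIn y (neg R) →
                     OrigEdge (NegDepends P) x y
DMSRule-negDepends (inj₁ (_ , refl)) _ (_ , () , _)
DMSRule-negDepends (inj₂ (r , r∈P , _ , _ , refl)) x∈ y∈
  with PredIn-map-liftA⁻ x∈ | PredIn-map-liftA⁻ y∈
... | _ , refl , p∈ | _ , refl , q∈ = lift (r , r∈P , p∈ , q∈)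

stratified-DMSRules : All (DMSRule P) O → Stratified P → Stratified O
stratified-DMSRules rules =
  stratified-reflect
    (λ (R , R∈ , x∈ , y∈) → DMSRule-depends (All.lookup rules R∈) x∈ y∈)
    (λ (R , R∈ , x∈ , y∈) → DMSRule-negDepends (All.lookup rules R∈) x∈ y∈)

DMSRulesOf : Program ℕ → State → Set
DMSRulesOf P st = All (DMSRule P) (magicRules st) × All (DMSRule P) (modifiedRules st)

magicA-magic : ∀ as → MagicAtoms (map magicA as)
magicA-magic as = map⁺ (All.universal (λ _ → tt) as)

handleOther-preserves : ∀ a {st} b → DMSRulesOf P st → DMSRulesOf P (handleOther P a st b)
handleOther-preserves {P} a b (mg , md) with not (atomEq b a) ∧ isIDB P (pred b)
... | true  = inj₁ (tt ∷ [] , refl) ∷ mg , md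
... | false = mg , md

handleHeadAtom-preserves : ∀ {r} → r ∈ P → ∀ {st} a → DMSRulesOf P st →
                           DMSRulesOf P (handleHeadAtom P r st a)
handleHeadAtom-preserves {P} {r} r∈P a (mg , md) =
  foldl-preservesʳ (DMSRulesOf P) (handleOther-preserves a) (atoms r)
    (mg , inj₂ (r , r∈P , map magicA (head r) , magicA-magic (head r) , refl) ∷ md)

processPred-preserves : ∀ p {st} → DMSRulesOf P st → DMSRulesOf P (processPred P p st)
processPred-preserves {P} p =
  foldl-preservesᵃ (DMSRulesOf P)
    (λ {_} {r} r∈P → foldl-preservesʳ (DMSRulesOf P) (headAtom r∈P) (head r)) (All.tabulate id)
  where
  headAtom : ∀ {r} → r ∈ P → ∀ {st} a → DMSRulesOf P st →
             DMSRulesOf P (if pred a ≡ᵇ p then handleHeadAtom P r st a else st)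
  headAtom r∈P a inv with pred a ≡ᵇ p
  ... | true  = handleHeadAtom-preserves r∈P a inv
  ... | false = inv

run-preserves : ∀ {st st′} → Star (Step P) st st′ → DMSRulesOf P st → DMSRulesOf P st′
run-preserves ε                  inv = inv
run-preserves (pick p _ ◅ steps) inv = run-preserves steps (processPred-preserves p inv)

dmsOutput-DMSRules : ∀ {Q st} → Star (Step P) (initState Q) st → All (DMSRule P) (dmsOutput P st)
dmsOutput-DMSRules {P} run with run-preserves run (inj₁ ([] , refl) ∷ [] , [])
... | mg , md = ++⁺ mg (++⁺ md (map⁺ (All.tabulate edb)))
  where
  edb : ∀ {r} → r ∈ EDB P → DMSRule P (liftR r)
  edb = inj₂ ∘ liftR-modified ∘ proj₁ ∘ ∈-filter⁻ _ {xs = P}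

-- Finite recursiveness and the query only matter for termination and
-- correctness of DMS; every run, terminated or not, produces DMS rules.
lemma3 : (P : Program ℕ) (Q : Atom ℕ) → ASPfs P → IsQuery P Q →
         FinitelyRecursive P Q → (O : Program MPred) → IsDMS Q P O → Stratified O
lemma3 P Q (_ , strat) _ _ _ (st , run , _ , refl) = stratified-DMSRules (dmsOutput-DMSRules run) strat
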